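{- $\Delta(1,2,2)$ is not a hero in orientations of chordal graphs; that is, for every integer $k$ there exists an orientation of a chordal graph containing no induced copy of $\Delta(1,2,2)$ and having dichromatic number greater than $k$.
   Context: All digraphs are finite and simple (no loops, no parallel arcs, no digons). An orientation of a chordal graph is a digraph whose underlying undirected graph has no induced cycle of length at least $4$. The dichromatic number of a digraph is the least $k$ such that its vertex set can be partitioned into $k$ sets each inducing an acyclic subdigraph. A digraph $H$ is a hero in a hereditary class $\mathcal{C}$ if the digraphs in $\mathcal{C}$ with no induced copy of $H$ have bounded dichromatic number. $TT_2$ is the tournament on two vertices (a single arc). $\Delta(1,2,2)$ is the tournament on $5$ vertices obtained from a vertex $x$ and two disjoint copies $A$, $B$ of $TT_2$ by adding all arcs from $x$ to $A$, all arcs from $A$ to $B$, and all arcs from $B$ to $x$. -}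

module Defs where

open import Data.Nat using (ℕ; zero; suc; _≤_)
open import Data.Fin using (Fin; toℕ; zero; suc)
open import Data.Bool using (Bool; true; false; _∨_)
open import Data.Product using (Σ; _×_; ∃-syntax)
open import Data.Sum using (_⊎_)
open import Relation.Binary.PropositionalEquality using (_≡_)
open import Relation.Nullary using (¬_)
open import Function.Bundles using (_⇔_)
open import Function.Definitions using (Injective)

record Digraph (n : ℕ) : Set where
  field
    arc      : Fin n → Fin n → Bool
    loopless : ∀ i → arc i i ≡ false
    noDigon  : ∀ i j → arc i j ≡ true → arc j i ≡ false
open Digraph public

adj : ∀ {n} → Digraph n → Fin n → Fin n → Bool
adj D i j = arc D i j ∨ arc D j i

CycNbr : ℕ → ℕ → ℕ → Set
CycNbr m a b = (b ≡ suc a) ⊎ (a ≡ suc b) ⊎ (a ≡ 0 × suc b ≡ m) ⊎ (b ≡ 0 × suc a ≡ m)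

InducedCycle : ∀ {n} → Digraph n → ℕ → Set
InducedCycle {n} D m =
  Σ (Fin m → Fin n) λ c → Injective _≡_ _≡_ c ×
    (∀ i j → (adj D (c i) (c j) ≡ true) ⇔ CycNbr m (toℕ i) (toℕ j))

OrientedChordal : ∀ {n} → Digraph n → Set
OrientedChordal D = ∀ m → 4 ≤ m → ¬ InducedCycle D m

InducedCopy : ∀ {h n} → Digraph h → Digraph n → Set
InducedCopy {h} {n} H D =
  Σ (Fin h → Fin n) λ f → Injective _≡_ _≡_ f ×
    (∀ i j → arc D (f i) (f j) ≡ arc H i j)

-- successor modulo (suc m) on Fin (suc m)
nextF : ∀ {m} → Fin (suc m) → Fin (suc m)
nextF {zero} _ = zero
nextF {suc m} zero = suc zero
nextF {suc m} (suc i) with nextF {m} i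
... | zero = zero
... | suc j = suc (suc j)

DirectedCycleIn : ∀ {n} → Digraph n → (Fin n → Set) → Set
DirectedCycleIn {n} D P =
  ∃[ m ] Σ (Fin (suc (suc m)) → Fin n) λ v → Injective _≡_ _≡_ v ×
    (∀ i → arc D (v i) (v (nextF i)) ≡ true) × (∀ i → P (v i))

DiColourable : ∀ {n} → Digraph n → ℕ → Set
DiColourable {n} D k =
  Σ (Fin n → Fin k) λ col → ∀ (c : Fin k) → ¬ DirectedCycleIn D (λ v → col v ≡ c)

DichromaticGreaterThan : ∀ {n} → Digraph n → ℕ → Set
DichromaticGreaterThan D k = ¬ DiColourable D k

-- Δ(1,2,2): x = 0, A = {1 → 2}, B = {3 → 4}; x → A, A → B, B → x
Δ122-arc : Fin 5 → Fin 5 → Bool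
Δ122-arc zero (suc zero) = true
Δ122-arc zero (suc (suc zero)) = true
Δ122-arc (suc zero) (suc (suc zero)) = true
Δ122-arc (suc (suc (suc zero))) (suc (suc (suc (suc zero)))) = true
Δ122-arc (suc zero) (suc (suc (suc zero))) = true
Δ122-arc (suc zero) (suc (suc (suc (suc zero)))) = true
Δ122-arc (suc (suc zero)) (suc (suc (suc zero))) = true
Δ122-arc (suc (suc zero)) (suc (suc (suc (suc zero)))) = true
Δ122-arc (suc (suc (suc zero))) zero = true
Δ122-arc (suc (suc (suc (suc zero)))) zero = true
Δ122-arc _ _ = false

Δ122 : Digraph 5
Δ122 = record { arc = Δ122-arc ; loopless = ll ; noDigon = nd }
  where
  ll : ∀ i → Δ122-arc i i ≡ false
  ll zero = _≡_.refl
  ll (suc zero) = _≡_.refl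
  ll (suc (suc zero)) = _≡_.refl
  ll (suc (suc (suc zero))) = _≡_.refl
  ll (suc (suc (suc (suc zero)))) = _≡_.refl
  nd : ∀ i j → Δ122-arc i j ≡ true → Δ122-arc j i ≡ false
  nd zero (suc zero) _ = _≡_.refl
  nd zero (suc (suc zero)) _ = _≡_.refl
  nd (suc zero) (suc (suc zero)) _ = _≡_.refl
  nd (suc (suc (suc zero))) (suc (suc (suc (suc zero)))) _ = _≡_.refl
  nd (suc zero) (suc (suc (suc zero))) _ = _≡_.refl
  nd (suc zero) (suc (suc (suc (suc zero)))) _ = _≡_.refl
  nd (suc (suc zero)) (suc (suc (suc zero))) _ = _≡_.refl
  nd (suc (suc zero)) (suc (suc (suc (suc zero)))) _ = _≡_.refl
  nd (suc (suc (suc zero))) zero _ = _≡_.refl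
  nd (suc (suc (suc (suc zero)))) zero _ = _≡_.refl
  nd zero zero ()
  nd zero (suc (suc (suc _))) ()
  nd (suc zero) zero ()
  nd (suc zero) (suc zero) ()
  nd (suc (suc zero)) zero ()
  nd (suc (suc zero)) (suc zero) ()
  nd (suc (suc zero)) (suc (suc zero)) ()
  nd (suc (suc (suc zero))) (suc zero) ()
  nd (suc (suc (suc zero))) (suc (suc zero)) ()
  nd (suc (suc (suc zero))) (suc (suc (suc zero))) ()
  nd (suc (suc (suc (suc zero)))) (suc _) ()

{-# OPTIONS --safe #-}
-- Start from one vertex and repeatedly replace a digraph D by its blowup: a vertex x, a copy A
-- of D, for every a ∈ A a further copy B_a of D, and all arcs x → A, a → B_a and B_a → x.
-- A colouring with k + 1 colours either misses the colour of x on A or on some B_a, and that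
-- copy of D then carries a monochromatic cycle by induction, or it produces a monochromatic
-- triangle x → a → b → x; so the dichromatic number grows at every step.  Ranking the B-vertices
-- below the A-vertices below x gives a perfect elimination ordering, so chordality survives.
-- An induced Δ(1,2,2) avoids x (x is the middle of no transitive triangle, and x's neighbours in
-- Δ(1,2,2) would force two of its A-vertices to coincide), cannot meet both A and a block B_a
-- (Δ(1,2,2) has no source, while an A-vertex only has in-neighbours in A and at most one A-vertex
-- is adjacent to a given B_a), and meets at most one block (it is a tournament); hence it lies
-- inside a copy of D.
module Submission where

open import Defs
open import Data.Nat using (ℕ; zero; suc; _+_; _*_; _≤_; _<_; z≤n; s≤s; s≤s⁻¹; _<?_)
open import Data.Nat.Properties
  using (_≤?_; ≰⇒>; ≮⇒≥; <⇒≤; <⇒≱; ≤-antisym; ≤-trans; ≤-refl; m≤m+n; +-monoʳ-≤; +-cancelˡ-≤; m≤n⇒m≤1+n)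
open import Data.Fin using (Fin; zero; suc; toℕ; fromℕ<; punchIn; punchOut)
open import Data.Fin.Patterns using (0F; 1F; 2F; 3F; 4F)
open import Data.Fin.Properties
  using (toℕ-fromℕ<; toℕ<n; punchIn-punchOut; all?; any?; 1↔⊤; +↔⊎; *↔×)
import Data.Fin.Properties as Fin
open import Data.Bool using (Bool; true; false; _∨_; _∧_)
open import Data.Bool.Properties using (∨-comm; ∨-identityʳ; ∧-conicalˡ)
import Data.Bool.Properties as Bool
open import Data.Product using (Σ; _×_; _,_; proj₁; proj₂; ∃; ∃-syntax)
open import Data.Sum using (_⊎_; inj₁; inj₂)
open import Data.Sum.Function.Propositional using (_⊎-↔_)
open import Data.Product.Function.NonDependent.Propositional using (_×-↔_)
open import Data.Unit using (⊤; tt)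
open import Data.Empty using (⊥; ⊥-elim)
open import Function using (_∘_; id; case_of_)
open import Function.Bundles using (_↔_; mk↔ₛ′; Equivalence; Inverse; Injection)
open import Function.Construct.Composition using (_↔-∘_)
open import Function.Construct.Identity using (↔-id)
open import Function.Construct.Symmetry using (↔-sym)
open import Function.Definitions using (Injective)
open import Function.Properties.Inverse using (↔⇒↣)
open import Relation.Binary.Definitions using (DecidableEquality)
open import Relation.Binary.PropositionalEquality
open import Relation.Nullary using (¬_; Dec; yes; no; does; contradiction)
open import Relation.Nullary.Decidable using (map′; from-yes; dec-true; _⊎-dec_)
open import Relation.Unary using (Decidable)

∨-true : ∀ {x y} → x ∨ y ≡ true → x ≡ true ⊎ y ≡ true
∨-true {true}  _ = inj₁ refl
∨-true {false} h = inj₂ h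

adjacent : {V : Set} → (V → V → Bool) → V → V → Bool
adjacent arc u v = arc u v ∨ arc v u

adjacent-comm : {V : Set} (arc : V → V → Bool) (u v : V) → adjacent arc u v ≡ adjacent arc v u
adjacent-comm arc u v = ∨-comm (arc u v) (arc v u)

arc-irreflexive : {V : Set} {arc : V → V → Bool} → (∀ x → arc x x ≡ false) →
                  ∀ {x y} → arc x y ≡ true → x ≢ y
arc-irreflexive {arc = arc} loopless {x} h refl with trans (sym h) (loopless x)
... | ()

∃?-via : {X : Set} {n : ℕ} → X ↔ Fin n → {P : X → Set} → Decidable P → Dec (∃ P)
∃?-via enum {P} P? = map′ (λ (i , p) → from i , p)
                          (λ (x , p) → to x , subst P (sym (strictlyInverseʳ x)) p)
                          (any? (P? ∘ from))
  where open Inverse enum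

Δ122-tournament : ∀ i j → i ≡ j ⊎ adjacent Δ122-arc i j ≡ true
Δ122-tournament = from-yes (all? λ i → all? λ j → i Fin.≟ j ⊎-dec (adjacent Δ122-arc i j Bool.≟ true))

Δ122-has-no-source : ∀ i → ∃[ l ] Δ122-arc l i ≡ true
Δ122-has-no-source = from-yes (all? λ i → any? λ l → Δ122-arc l i Bool.≟ true)

Cycle : {V : Set} → (V → V → Bool) → (V → Set) → Set
Cycle {V} arc P = ∃[ m ] Σ (Fin (suc (suc m)) → V) λ v → Injective _≡_ _≡_ v ×
    (∀ i → arc (v i) (v (nextF i)) ≡ true) × (∀ i → P (v i))

Cycle-map : {X Y : Set} {arcX : X → X → Bool} {arcY : Y → Y → Bool} {P : X → Set} {Q : Y → Set}
  (e : X → Y) → Injective _≡_ _≡_ e → (∀ {x y} → arcX x y ≡ true → arcY (e x) (e y) ≡ true) →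
  (∀ {x} → P x → Q (e x)) → Cycle arcX P → Cycle arcY Q
Cycle-map e e-inj e-arc e-P (m , v , v-inj , v-arc , v-P) =
  m , e ∘ v , v-inj ∘ e-inj , e-arc ∘ v-arc , e-P ∘ v-P

triangle-Cycle : {V : Set} {arc : V → V → Bool} {P : V → Set} → (∀ x → arc x x ≡ false) →
  ∀ {u v w} → arc u v ≡ true → arc v w ≡ true → arc w u ≡ true → P u → P v → P w → Cycle arc P
triangle-Cycle {V} {arc} {P} loopless {u} {v} {w} uv vw wu pu pv pw = 1 , t , t-inj , t-arc , t-P
  where
  t : Fin 3 → V
  t 0F = u
  t 1F = v
  t 2F = w
  distinct : ∀ {x y} → arc x y ≡ true → x ≢ y
  distinct = arc-irreflexive loopless
  t-inj : Injective _≡_ _≡_ t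
  t-inj {0F} {0F} _ = refl
  t-inj {1F} {1F} _ = refl
  t-inj {2F} {2F} _ = refl
  t-inj {0F} {1F} e = contradiction e (distinct uv)
  t-inj {0F} {2F} e = contradiction (sym e) (distinct wu)
  t-inj {1F} {0F} e = contradiction (sym e) (distinct uv)
  t-inj {1F} {2F} e = contradiction e (distinct vw)
  t-inj {2F} {0F} e = contradiction e (distinct wu)
  t-inj {2F} {1F} e = contradiction (sym e) (distinct vw)
  t-arc : ∀ i → arc (t i) (t (nextF i)) ≡ true
  t-arc 0F = uv
  t-arc 1F = vw
  t-arc 2F = wu
  t-P : ∀ i → P (t i)
  t-P 0F = pu
  t-P 1F = pv
  t-P 2F = pw

NotDiColourable : {V : Set} → (V → V → Bool) → ℕ → Set
NotDiColourable {V} arc k = ∀ (col : V → Fin k) → ∃[ c ] Cycle arc (λ v → col v ≡ c)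

-- Removing the avoided colour c by punchOut leaves a k-colouring of X; punchIn c recovers it.
Cycle-avoiding-colour : {X Y : Set} {arcX : X → X → Bool} {arcY : Y → Y → Bool} {k : ℕ} →
  NotDiColourable arcX k → (e : X → Y) → Injective _≡_ _≡_ e →
  (∀ {x y} → arcX x y ≡ true → arcY (e x) (e y) ≡ true) →
  (col : Y → Fin (suc k)) {c : Fin (suc k)} → (∀ x → col (e x) ≢ c) →
  ∃[ d ] Cycle arcY (λ y → col y ≡ d)
Cycle-avoiding-colour {arcY = arcY} notCol e e-inj e-arc col {c} avoids
  with notCol (λ x → punchOut (avoids x ∘ sym))
... | c′ , cycle =
  punchIn c c′ , Cycle-map {arcY = arcY} {Q = λ y → col y ≡ punchIn c c′} e e-inj e-arc recolour cycle
  where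
  recolour : ∀ {x} → punchOut (avoids x ∘ sym) ≡ c′ → col (e x) ≡ punchIn c c′
  recolour {x} eq = trans (sym (punchIn-punchOut (avoids x ∘ sym))) (cong (punchIn c) eq)

IsΔ122 : {V : Set} → (V → V → Bool) → (Fin 5 → V) → Set
IsΔ122 arc f = Injective _≡_ _≡_ f × (∀ i j → arc (f i) (f j) ≡ Δ122-arc i j)

Δ122Free : {V : Set} → (V → V → Bool) → Set
Δ122Free arc = ∀ f → ¬ IsΔ122 arc f

IsΔ122-restrict : {X Y : Set} {arcX : X → X → Bool} {arcY : Y → Y → Bool} (e : X → Y) →
  (∀ x y → arcY (e x) (e y) ≡ arcX x y) → {f : Fin 5 → Y} {g : Fin 5 → X} →
  (∀ i → f i ≡ e (g i)) → IsΔ122 arcY f → IsΔ122 arcX g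
IsΔ122-restrict {arcX = arcX} {arcY} e e-arc {f} {g} f≡eg (f-inj , f-arc) = g-inj , g-arc
  where
  g-inj : Injective _≡_ _≡_ g
  g-inj {i} {j} eq = f-inj (trans (f≡eg i) (trans (cong e eq) (sym (f≡eg j))))
  g-arc : ∀ i j → arcX (g i) (g j) ≡ Δ122-arc i j
  g-arc i j = trans (sym (e-arc (g i) (g j)))
                (trans (sym (cong₂ arcY (f≡eg i) (f≡eg j))) (f-arc i j))

-- Chordality via elimination rankings

-- Sorting the vertices by rank gives a perfect elimination ordering.
EliminationRank : {V : Set} → (V → V → Bool) → (V → ℕ) → Set
EliminationRank {V} arc rank = ∀ (v u w : V) →
  adjacent arc v u ≡ true → adjacent arc v w ≡ true → rank v ≤ rank u → rank v ≤ rank w →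
  u ≢ w → adjacent arc u w ≡ true

argmin : ∀ {m} (g : Fin (suc m) → ℕ) → Σ (Fin (suc m)) λ i → ∀ j → g i ≤ g j
argmin {zero} g = zero , λ { zero → ≤-refl }
argmin {suc m} g with argmin (g ∘ suc)
... | i , min with g zero ≤? g (suc i)
... | yes g0≤ = zero , λ { zero → ≤-refl ; (suc j) → ≤-trans g0≤ (min j) }
... | no g0≰ = suc i , λ { zero → <⇒≤ (≰⇒> g0≰) ; (suc j) → min j }

-- Positions t - 1 and t + 1 (mod m) on a cycle of length m ≥ 4.
cycle-neighbours : ∀ p t → t < 4 + p → let m = 4 + p in
  Σ ℕ λ s₁ → Σ ℕ λ s₂ → s₁ < m × s₂ < m × CycNbr m t s₁ × CycNbr m t s₂ × s₁ ≢ s₂ × ¬ CycNbr m s₁ s₂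
cycle-neighbours p zero _ = 1 , 3 + p , s≤s (s≤s z≤n) , ≤-refl , inj₁ refl ,
  inj₂ (inj₂ (inj₁ (refl , refl))) , (λ ()) ,
  λ { (inj₁ ()) ; (inj₂ (inj₁ ())) ; (inj₂ (inj₂ (inj₁ (() , _)))) ; (inj₂ (inj₂ (inj₂ (() , _)))) }
cycle-neighbours p (suc s) (s≤s t<m) with suc s <? 3 + p
... | yes (s≤s s+1<) = s , suc (suc s) , m≤n⇒m≤1+n (m≤n⇒m≤1+n s+1<) , s≤s (s≤s s+1<) ,
  inj₂ (inj₁ refl) , inj₁ refl , (λ ()) ,
  λ { (inj₁ ()) ; (inj₂ (inj₁ ())) ; (inj₂ (inj₂ (inj₁ (refl , ())))) ; (inj₂ (inj₂ (inj₂ (() , _)))) }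
... | no s+1≮ with ≤-antisym (s≤s⁻¹ t<m) (s≤s⁻¹ (≮⇒≥ s+1≮))
... | refl = 2 + p , 0 , m≤n⇒m≤1+n ≤-refl , s≤s z≤n , inj₂ (inj₁ refl) ,
  inj₂ (inj₂ (inj₂ (refl , refl))) , (λ ()) ,
  λ { (inj₁ ()) ; (inj₂ (inj₁ ())) ; (inj₂ (inj₂ (inj₁ (() , _)))) ; (inj₂ (inj₂ (inj₂ (_ , ())))) }

-- A vertex of minimal rank on an induced cycle of length ≥ 4 would need adjacent cycle-neighbours.
EliminationRank⇒OrientedChordal : ∀ {n} (D : Digraph n) (rank : Fin n → ℕ) →
  EliminationRank (arc D) rank → OrientedChordal D
EliminationRank⇒OrientedChordal D rank elim (suc (suc (suc (suc p)))) (s≤s (s≤s (s≤s (s≤s _))))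
  (c , c-inj , c-adj) with argmin (rank ∘ c)
... | i , minimal with cycle-neighbours p (toℕ i) (toℕ<n i)
... | s₁ , s₂ , s₁<m , s₂<m , i~s₁ , i~s₂ , s₁≢s₂ , s₁≁s₂ =
  s₁≁s₂ (subst₂ (CycNbr (4 + p)) e₁ e₂ (Equivalence.to (c-adj j₁ j₂) j₁-adj-j₂))
  where
  j₁ = fromℕ< s₁<m
  j₂ = fromℕ< s₂<m
  e₁ = toℕ-fromℕ< s₁<m
  e₂ = toℕ-fromℕ< s₂<m
  i-adj : ∀ {s} (s<m : s < 4 + p) → CycNbr (4 + p) (toℕ i) s → adj D (c i) (c (fromℕ< s<m)) ≡ true
  i-adj s<m i~s =
    Equivalence.from (c-adj i (fromℕ< s<m)) (subst (CycNbr _ _) (sym (toℕ-fromℕ< s<m)) i~s)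
  j₁-adj-j₂ = elim (c i) (c j₁) (c j₂) (i-adj s₁<m i~s₁) (i-adj s₂<m i~s₂) (minimal j₁) (minimal j₂)
                (λ eq → s₁≢s₂ (trans (sym e₁) (trans (cong toℕ (c-inj eq)) e₂)))

record FinDigraph : Set₁ where
  field
    Vertex    : Set
    size      : ℕ
    enum      : Vertex ↔ Fin size
    arcᴳ      : Vertex → Vertex → Bool
    looplessᴳ : ∀ v → arcᴳ v v ≡ false
    noDigonᴳ  : ∀ u v → arcᴳ u v ≡ true → arcᴳ v u ≡ false

  open Inverse enum public using (to; from; strictlyInverseʳ)

  to-injective : Injective _≡_ _≡_ to
  to-injective = Injection.injective (↔⇒↣ enum)

  from-injective : Injective _≡_ _≡_ from
  from-injective = Injection.injective (↔⇒↣ (↔-sym enum))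

  _≟_ : DecidableEquality Vertex
  x ≟ y = map′ to-injective (cong to) (to x Fin.≟ to y)

record Ranking {V : Set} (arc : V → V → Bool) : Set where
  field
    rank        : V → ℕ
    bound       : ℕ
    rank<bound  : ∀ v → rank v < bound
    elimination : EliminationRank arc rank

toDigraph : (G : FinDigraph) → Digraph (FinDigraph.size G)
toDigraph G = record
  { arc      = λ i j → arcᴳ (from i) (from j)
  ; loopless = λ i → looplessᴳ (from i)
  ; noDigon  = λ i j → noDigonᴳ (from i) (from j) }
  where open FinDigraph G

module _ (G : FinDigraph) where
  open FinDigraph G

  toDigraph-chordal : Ranking arcᴳ → OrientedChordal (toDigraph G)
  toDigraph-chordal ranking = EliminationRank⇒OrientedChordal (toDigraph G) (rank ∘ from)
    λ v u w v~u v~w ≤u ≤w u≢w →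
      elimination (from v) (from u) (from w) v~u v~w ≤u ≤w (u≢w ∘ from-injective)
    where open Ranking ranking

  toDigraph-Δ122Free : Δ122Free arcᴳ → ¬ InducedCopy Δ122 (toDigraph G)
  toDigraph-Δ122Free free (f , f-inj , f-arc) = free (from ∘ f) (f-inj ∘ from-injective , f-arc)

  toDigraph-notColourable : ∀ {k} → NotDiColourable arcᴳ k → DichromaticGreaterThan (toDigraph G) k
  toDigraph-notColourable notCol (col , acyclic) with notCol (col ∘ to)
  ... | c , cycle =
    acyclic c (Cycle-map {arcY = arc (toDigraph G)} {Q = λ i → col i ≡ c} to to-injective to-arc id cycle)
    where
    to-arc : ∀ {x y} → arcᴳ x y ≡ true → arcᴳ (from (to x)) (from (to y)) ≡ true
    to-arc {x} {y} =
      subst₂ (λ u v → arcᴳ u v ≡ true) (sym (strictlyInverseʳ x)) (sym (strictlyInverseʳ y))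

-- The blowup

data Blowup (X : Set) : Set where
  apex : Blowup X
  inA  : X → Blowup X
  inB  : X → X → Blowup X

Blowup↔⊎ : {X : Set} → Blowup X ↔ (⊤ ⊎ (X ⊎ X × X))
Blowup↔⊎ = mk↔ₛ′ to from to-from from-to
  where
  to : Blowup _ → ⊤ ⊎ (_ ⊎ _ × _)
  to apex = inj₁ tt
  to (inA a) = inj₂ (inj₁ a)
  to (inB a b) = inj₂ (inj₂ (a , b))
  from : ⊤ ⊎ (_ ⊎ _ × _) → Blowup _
  from (inj₁ tt) = apex
  from (inj₂ (inj₁ a)) = inA a
  from (inj₂ (inj₂ (a , b))) = inB a b
  to-from : ∀ s → to (from s) ≡ s
  to-from (inj₁ tt) = refl
  to-from (inj₂ (inj₁ a)) = refl
  to-from (inj₂ (inj₂ (a , b))) = refl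
  from-to : ∀ w → from (to w) ≡ w
  from-to apex = refl
  from-to (inA a) = refl
  from-to (inB a b) = refl

Blowup-enum : {X : Set} {n : ℕ} → X ↔ Fin n → Blowup X ↔ Fin (suc (n + n * n))
Blowup-enum {X} {n} enum = ↔-sym (fin ↔-∘ +↔⊎) ↔-∘ (shape ↔-∘ Blowup↔⊎)
  where
  shape : (⊤ ⊎ (X ⊎ X × X)) ↔ (⊤ ⊎ (Fin n ⊎ Fin n × Fin n))
  shape = ↔-id ⊤ ⊎-↔ enum ⊎-↔ enum ×-↔ enum
  fin : (Fin 1 ⊎ Fin (n + n * n)) ↔ (⊤ ⊎ (Fin n ⊎ Fin n × Fin n))
  fin = 1↔⊤ ⊎-↔ ((↔-id (Fin n) ⊎-↔ *↔×) ↔-∘ +↔⊎)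

module _ {X : Set} (_≟_ : DecidableEquality X) (arc : X → X → Bool) where

  arcᴮ : Blowup X → Blowup X → Bool
  arcᴮ apex      (inA _)     = true
  arcᴮ (inA a)   (inA a′)    = arc a a′
  arcᴮ (inA a)   (inB a′ _)  = does (a ≟ a′)
  arcᴮ (inB a b) (inB a′ b′) = does (a ≟ a′) ∧ arc b b′
  arcᴮ (inB _ _) apex        = true
  arcᴮ _         _           = false

  private
    ≟-refl : ∀ a → does (a ≟ a) ≡ true
    ≟-refl a = dec-true (a ≟ a) refl

    does⇒≡ : ∀ {a a′} → does (a ≟ a′) ≡ true → a ≡ a′
    does⇒≡ {a} {a′} h with a ≟ a′
    ... | yes a≡a′ = a≡a′
    does⇒≡ () | no _

  inB-arc : ∀ a x y → arcᴮ (inB a x) (inB a y) ≡ arc x y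
  inB-arc a x y = cong (_∧ arc x y) (≟-refl a)

  adj-inA-inB : ∀ {a a′} b → adjacent arcᴮ (inA a) (inB a′ b) ≡ true → a ≡ a′
  adj-inA-inB {a} {a′} _ h = does⇒≡ (trans (sym (∨-identityʳ (does (a ≟ a′)))) h)

  adj-inB-inA : ∀ {a a′} b → adjacent arcᴮ (inB a′ b) (inA a) ≡ true → a ≡ a′
  adj-inB-inA {a} {a′} b h = adj-inA-inB b (trans (adjacent-comm arcᴮ (inA a) (inB a′ b)) h)

  adj-inA-inB-same : ∀ a b → adjacent arcᴮ (inA a) (inB a b) ≡ true
  adj-inA-inB-same a b = cong (_∨ false) (≟-refl a)

  adj-inB-block : ∀ {a a′ b b′} → adjacent arcᴮ (inB a b) (inB a′ b′) ≡ true → a ≡ a′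
  adj-inB-block h with ∨-true h
  ... | inj₁ ab = does⇒≡ (∧-conicalˡ _ _ ab)
  ... | inj₂ ba = sym (does⇒≡ (∧-conicalˡ _ _ ba))

  adj-inB-inB : ∀ {a a′ b b′} → adjacent arcᴮ (inB a b) (inB a′ b′) ≡ true →
                a ≡ a′ × adjacent arc b b′ ≡ true
  adj-inB-inB {a} {_} {b} {b′} h with refl ← adj-inB-block h =
    refl , trans (sym (cong₂ _∨_ (inB-arc a b b′) (inB-arc a b′ b))) h

  looplessᴮ : (∀ x → arc x x ≡ false) → ∀ w → arcᴮ w w ≡ false
  looplessᴮ loopless apex = refl
  looplessᴮ loopless (inA a) = loopless a
  looplessᴮ loopless (inB a b) = trans (inB-arc a b b) (loopless b)

  noDigonᴮ : (∀ x y → arc x y ≡ true → arc y x ≡ false) →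
             ∀ u w → arcᴮ u w ≡ true → arcᴮ w u ≡ false
  noDigonᴮ noDigon apex      (inA _)     _ = refl
  noDigonᴮ noDigon (inB _ _) apex        _ = refl
  noDigonᴮ noDigon (inA a)   (inA a′)    h = noDigon a a′ h
  noDigonᴮ noDigon (inA _)   (inB _ _)   _ = refl
  noDigonᴮ noDigon (inB a b) (inB a′ b′) h with refl ← does⇒≡ (∧-conicalˡ _ _ h) =
    trans (inB-arc a b′ b) (noDigon b b′ (trans (sym (inB-arc a b b′)) h))

  Rankingᴮ : Ranking arc → Ranking arcᴮ
  Rankingᴮ ranking = record
    { rank = rankᴮ ; bound = suc (bound + bound)
    ; rank<bound = rankᴮ<bound ; elimination = eliminationᴮ }
    where
    open Ranking ranking
    rankᴮ : Blowup X → ℕ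
    rankᴮ apex = bound + bound
    rankᴮ (inA a) = bound + rank a
    rankᴮ (inB _ b) = rank b

    rankᴮ<bound : ∀ w → rankᴮ w < suc (bound + bound)
    rankᴮ<bound apex = s≤s ≤-refl
    rankᴮ<bound (inA a) = s≤s (+-monoʳ-≤ bound (<⇒≤ (rank<bound a)))
    rankᴮ<bound (inB _ b) = m≤n⇒m≤1+n (≤-trans (rank<bound b) (m≤m+n bound bound))

    bound≰ : ∀ {t} x → ¬ bound + t ≤ rank x
    bound≰ {t} x le = <⇒≱ (rank<bound x) (≤-trans (m≤m+n bound t) le)

    apex≰inA : ∀ a → ¬ bound + bound ≤ bound + rank a
    apex≰inA a le = <⇒≱ (rank<bound a) (+-cancelˡ-≤ bound bound (rank a) le)

    eliminationᴮ : EliminationRank arcᴮ rankᴮ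
    eliminationᴮ apex      apex        _           ()
    eliminationᴮ apex      (inA a)     _           _ _ ≤u _ _ = contradiction ≤u (apex≰inA a)
    eliminationᴮ apex      (inB _ b)   _           _ _ ≤u _ _ = contradiction ≤u (bound≰ b)
    eliminationᴮ (inA _)   apex        apex        _ _ _ _ u≢w = contradiction refl u≢w
    eliminationᴮ (inA _)   apex        (inA _)     _ _ _ _ _ = refl
    eliminationᴮ (inA _)   apex        (inB _ b)   _ _ _ ≤w _ = contradiction ≤w (bound≰ b)
    eliminationᴮ (inA _)   (inA _)     apex        _ _ _ _ _ = refl
    eliminationᴮ (inA a)   (inA a₁)    (inA a₂)    v~u v~w ≤u ≤w u≢w =
      elimination a a₁ a₂ v~u v~w (+-cancelˡ-≤ bound _ _ ≤u) (+-cancelˡ-≤ bound _ _ ≤w) (u≢w ∘ cong inA)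
    eliminationᴮ (inA _)   (inA _)     (inB _ b)   _ _ _ ≤w _ = contradiction ≤w (bound≰ b)
    eliminationᴮ (inA _)   (inB _ b)   _           _ _ ≤u _ _ = contradiction ≤u (bound≰ b)
    eliminationᴮ (inB _ _) apex        apex        _ _ _ _ u≢w = contradiction refl u≢w
    eliminationᴮ (inB _ _) apex        (inA _)     _ _ _ _ _ = refl
    eliminationᴮ (inB _ _) apex        (inB _ _)   _ _ _ _ _ = refl
    eliminationᴮ (inB _ _) (inA _)     apex        _ _ _ _ _ = refl
    eliminationᴮ (inB _ _) (inB _ _)   apex        _ _ _ _ _ = refl
    eliminationᴮ (inB _ b) (inA _)     (inA _)     v~u v~w _ _ u≢w
      with refl ← adj-inB-inA b v~u | refl ← adj-inB-inA b v~w = contradiction refl u≢w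
    eliminationᴮ (inB _ b) (inA _)     (inB _ b₂)  v~u v~w _ _ _
      with refl ← adj-inB-inA b v~u | refl , _ ← adj-inB-inB v~w = adj-inA-inB-same _ b₂
    eliminationᴮ (inB _ b) (inB _ b₁)  (inA a₂)    v~u v~w _ _ _
      with refl , _ ← adj-inB-inB v~u | refl ← adj-inB-inA b v~w =
      trans (adjacent-comm arcᴮ (inB a₂ b₁) (inA a₂)) (adj-inA-inB-same a₂ b₁)
    eliminationᴮ (inB a b) (inB _ b₁)  (inB _ b₂)  v~u v~w ≤u ≤w u≢w
      with refl , b~b₁ ← adj-inB-inB v~u | refl , b~b₂ ← adj-inB-inB v~w =
      trans (cong₂ _∨_ (inB-arc a b₁ b₂) (inB-arc a b₂ b₁))
            (elimination b b₁ b₂ b~b₁ b~b₂ ≤u ≤w (u≢w ∘ cong (inB a)))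

  module InducedΔ122 {f : Fin 5 → Blowup X} (copy : IsΔ122 arcᴮ f) where
    f-inj : Injective _≡_ _≡_ f
    f-inj = proj₁ copy

    f-arc : ∀ i j → arcᴮ (f i) (f j) ≡ Δ122-arc i j
    f-arc = proj₂ copy

    arc-between : ∀ i j {u w} → f i ≡ u → f j ≡ w → Δ122-arc i j ≡ true → arcᴮ u w ≡ true
    arc-between i j fi fj ij = subst₂ (λ u w → arcᴮ u w ≡ true) fi fj (trans (f-arc i j) ij)

    adjacent-between : ∀ {i j u w} → f i ≡ u → f j ≡ w → i ≢ j → adjacent arcᴮ u w ≡ true
    adjacent-between {i} {j} fi fj i≢j with Δ122-tournament i j
    ... | inj₁ i≡j = contradiction i≡j i≢j
    ... | inj₂ i~j = subst₂ (λ u w → adjacent arcᴮ u w ≡ true) fi fj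
                       (trans (cong₂ _∨_ (f-arc i j) (f-arc j i)) i~j)

    apex-out : ∀ w → arcᴮ apex w ≡ true → ∃[ a ] w ≡ inA a
    apex-out (inA a) _ = a , refl

    apex-in : ∀ w → arcᴮ w apex ≡ true → ∃[ a ] ∃[ b ] w ≡ inB a b
    apex-in (inB a b) _ = a , b , refl

    apex-not-transitive-middle : ∀ l i j → f i ≡ apex →
      Δ122-arc l i ≡ true → Δ122-arc i j ≡ true → Δ122-arc l j ≡ true → ⊥
    apex-not-transitive-middle l i j fi li ij lj
      with apex-in (f l) (arc-between l i refl fi li) | apex-out (f j) (arc-between i j fi refl ij)
    ... | _ , _ , fl | _ , fj with () ← arc-between l j fl fj lj

    -- x → 1, 2 and 3 → x put 1, 2 in A and 3 in B; the arcs 1, 2 → 3 then force f 1 ≡ f 2.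
    x-not-apex : f 0F ≢ apex
    x-not-apex f0
      with apex-out (f 1F) (arc-between 0F 1F f0 refl refl)
         | apex-out (f 2F) (arc-between 0F 2F f0 refl refl)
         | apex-in (f 3F) (arc-between 3F 0F refl f0 refl)
    ... | _ , f1 | _ , f2 | _ , b , f3
      with refl ← adj-inA-inB b (adjacent-between f1 f3 (λ ()))
         | refl ← adj-inA-inB b (adjacent-between f2 f3 (λ ()))
      with () ← f-inj (trans f1 (sym f2))

    not-apex : ∀ i → f i ≢ apex
    not-apex 0F = x-not-apex
    not-apex 1F f1 = apex-not-transitive-middle 0F 1F 2F f1 refl refl refl
    not-apex 2F f2 = apex-not-transitive-middle 1F 2F 3F f2 refl refl refl
    not-apex 3F f3 = apex-not-transitive-middle 2F 3F 4F f3 refl refl refl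
    not-apex 4F f4 = apex-not-transitive-middle 3F 4F 0F f4 refl refl refl

    preimages-distinct : ∀ {i j u w} → f i ≡ u → f j ≡ w → u ≢ w → i ≢ j
    preimages-distinct fi fj u≢w refl = u≢w (trans (sym fi) fj)

    not-A-and-B : ∀ {i j a a′ b} → f i ≡ inA a → f j ≡ inB a′ b → ⊥
    not-A-and-B {i} {j} {b = b} fi fj with Δ122-has-no-source i
    ... | l , li with f l in fl
    ... | apex = not-apex l fl
    ... | inB _ _ with () ← arc-between l i fl fi li
    ... | inA _ with refl ← adj-inA-inB b (adjacent-between fl fj (preimages-distinct fl fj λ ()))
                   | refl ← adj-inA-inB b (adjacent-between fi fj (preimages-distinct fi fj λ ())) =
      arc-irreflexive (Digraph.loopless Δ122) li (f-inj (trans fl (sym fi)))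

    same-block : ∀ {i j a a′ b b′} → f i ≡ inB a b → f j ≡ inB a′ b′ → a ≡ a′
    same-block {i} {j} fi fj with i Fin.≟ j
    ... | yes refl with refl ← trans (sym fi) fj = refl
    ... | no i≢j = adj-inB-block (adjacent-between fi fj i≢j)

    within-A : ∀ {a} → f 0F ≡ inA a → ∀ j → ∃[ a′ ] f j ≡ inA a′
    within-A f0 j with f j in fj
    ... | apex = contradiction fj (not-apex j)
    ... | inA a′ = a′ , refl
    ... | inB _ _ = ⊥-elim (not-A-and-B f0 fj)

    within-B : ∀ {a b} → f 0F ≡ inB a b → ∀ j → ∃[ b′ ] f j ≡ inB a b′
    within-B f0 j with f j in fj
    ... | apex = contradiction fj (not-apex j)
    ... | inA _ = ⊥-elim (not-A-and-B fj f0)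
    ... | inB _ b′ with refl ← same-block f0 fj = b′ , refl

    in-copy-of-D : ∃[ g ] IsΔ122 arc g
    in-copy-of-D with f 0F in f0
    ... | apex = contradiction f0 (not-apex 0F)
    ... | inA _ = proj₁ ∘ within-A f0 ,
      IsΔ122-restrict {arcY = arcᴮ} inA (λ _ _ → refl) (proj₂ ∘ within-A f0) copy
    ... | inB a _ = proj₁ ∘ within-B f0 ,
      IsΔ122-restrict {arcY = arcᴮ} (inB a) (inB-arc a) (proj₂ ∘ within-B f0) copy

  Δ122Freeᴮ : Δ122Free arc → Δ122Free arcᴮ
  Δ122Freeᴮ free f copy = let g , g-copy = InducedΔ122.in-copy-of-D copy in free g g-copy

  NotDiColourableᴮ : ∀ {n k} → X ↔ Fin n → (∀ x → arc x x ≡ false) →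
                     NotDiColourable arc k → NotDiColourable arcᴮ (suc k)
  NotDiColourableᴮ enum loopless notCol col
    with ∃?-via enum (λ a → col (inA a) Fin.≟ col apex)
  ... | no none =
    Cycle-avoiding-colour {arcY = arcᴮ} notCol inA (λ { refl → refl }) id col (λ a ca → none (a , ca))
  ... | yes (a , ca) with ∃?-via enum (λ b → col (inB a b) Fin.≟ col apex)
  ...   | yes (b , cb) = col apex , triangle-Cycle {arc = arcᴮ} {P = λ w → col w ≡ col apex}
                                      (looplessᴮ loopless) refl (≟-refl a) refl refl ca cb
  ...   | no none = Cycle-avoiding-colour {arcY = arcᴮ} notCol (inB a) (λ { refl → refl })
                      (λ {x} {y} xy → trans (inB-arc a x y) xy) col (λ b cb → none (b , cb))

-- The tower of blowups

blowup : FinDigraph → FinDigraph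
blowup G = record
  { Vertex    = Blowup Vertex
  ; size      = suc (size + size * size)
  ; enum      = Blowup-enum enum
  ; arcᴳ      = arcᴮ _≟_ arcᴳ
  ; looplessᴳ = looplessᴮ _≟_ arcᴳ looplessᴳ
  ; noDigonᴳ  = noDigonᴮ _≟_ arcᴳ noDigonᴳ }
  where open FinDigraph G

point : FinDigraph
point = record
  { Vertex = ⊤ ; size = 1 ; enum = ↔-sym 1↔⊤
  ; arcᴳ = λ _ _ → false ; looplessᴳ = λ _ → refl ; noDigonᴳ = λ _ _ _ → refl }

record Witness (k : ℕ) : Set₁ where
  field
    graph          : FinDigraph
    ranking        : Ranking (FinDigraph.arcᴳ graph)
    Δ122-free      : Δ122Free (FinDigraph.arcᴳ graph)
    not-colourable : NotDiColourable (FinDigraph.arcᴳ graph) k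

witness : ∀ k → Witness k
witness zero = record
  { graph = point
  ; ranking = record { rank = λ _ → 0 ; bound = 1 ; rank<bound = λ _ → s≤s z≤n ; elimination = λ _ _ _ () }
  ; Δ122-free = λ f (_ , f-arc) → case f-arc 0F 1F of λ ()
  ; not-colourable = λ col → case col tt of λ () }
witness (suc k) = record
  { graph = blowup graph
  ; ranking = Rankingᴮ _≟_ arcᴳ ranking
  ; Δ122-free = Δ122Freeᴮ _≟_ arcᴳ Δ122-free
  ; not-colourable = NotDiColourableᴮ _≟_ arcᴳ enum looplessᴳ not-colourable }
  where open Witness (witness k) ; open FinDigraph graph

theorem2p6 : (k : ℕ) → Σ ℕ λ n → Σ (Digraph n) λ D →
               OrientedChordal D × ¬ InducedCopy Δ122 D × DichromaticGreaterThan D k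
theorem2p6 k = FinDigraph.size graph , toDigraph graph ,
  toDigraph-chordal graph ranking , toDigraph-Δ122Free graph Δ122-free ,
  toDigraph-notColourable graph not-colourable
  where open Witness (witness k)
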